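{- The decomposition space $\mathbf K$ (described in the context) is locally finite, locally discrete and of locally finite length.
   Context: A contraction is a map of posets $f\colon P\to Q$ which is a monotone surjection, whose fibres $P_q=f^{ -1}(q)$ are connected convex subposets of $P$, and such that for every cover $q\lessdot q'$ in $Q$ (i.e. $q<q'$ with nothing strictly between) there is a cover $p\lessdot p'$ in $P$ with $f(p)=q$, $f(p')=q'$. $\mathbf K$ is the pseudosimplicial groupoid with: $\mathbf K_0$ the groupoid of finite families of one-element posets; $\mathbf K_1$ the groupoid of finite families of finite connected non-empty posets (morphisms: bijections of index sets with poset isomorphisms); for $n\ge2$, $\mathbf K_n$ the groupoid of finite families of chains $P_0\twoheadrightarrow\cdots\twoheadrightarrow P_{n-1}$ of contractions of finite connected non-empty posets. Componentwise on a chain: $d_0$ deletes $P_0$, inner faces compose, $d_{n-1}$ deletes $P_{n-1}$, the top face $d_n$ returns the family of fibre chains over the elements of $P_{n-1}$; on $\mathbf K_1$, $d_0$ sends $P$ to the one-element poset and $d_1$ sends $P$ to the family of one-element posets indexed by $P$; degeneracies insert identities, $s_0\colon\mathbf K_0\to\mathbf K_1$ is the inclusion, top degeneracies append $P_{n-1}\twoheadrightarrow1$. $\mathbf K$ is a decomposition space. A decomposition space $X$ is locally finite if $X_1$ is a locally finite groupoid (finite automorphism groups) and $s_0\colon X_0\to X_1$ and $d_1\colon X_2\to X_1$ have finite homotopy fibres; locally discrete if these maps have discrete homotopy fibres; of locally finite length if for every $a\in X_1$ there is an upper bound on the $n$ for which the homotopy fibre over $a$ of the long-edge map $X_n\to X_1$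 (induced by the endpoint-preserving map $[1]\to[n]$) contains non-degenerate simplices. -}

module Defs where

open import Data.Nat using (ℕ; zero; suc; _≤_)
open import Data.Fin using (Fin; zero; suc)
open import Data.Bool using (Bool; true; false; T)
open import Data.Unit using (⊤; tt)
open import Data.Empty using (⊥; ⊥-elim)
open import Data.Product using (Σ; ∃; ∃₂; _×_; _,_; proj₁; proj₂)
open import Data.Sum using (_⊎_; inj₁; inj₂)
open import Data.List using (List)
open import Data.List.Relation.Unary.Any using (Any)
open import Relation.Binary.PropositionalEquality
open import Relation.Nullary using (¬_)

-- We record only the structure needed to state the notions of the paper:
-- objects, morphisms (all of which are invertible in the groupoids below),
-- the equality of parallel morphisms, and (for the base of a homotopy fibre)
-- composition.  Groupoid laws are not recorded as fields; they play no
-- role in the statement.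

record GpdData : Set₁ where
  field
    Ob  : Set
    Mor : Ob → Ob → Set
    _≃_ : ∀ {x y} → Mor x y → Mor x y → Set

record Groupoid : Set₁ where
  field
    Obj : Set
    Hom : Obj → Obj → Set
    _≈_ : ∀ {x y} → Hom x y → Hom x y → Set
    _∘_ : ∀ {x y z} → Hom y z → Hom x y → Hom x z

open Groupoid public using (Obj; Hom)

underlying : Groupoid → GpdData
underlying G = record { Ob = Groupoid.Obj G ; Mor = Groupoid.Hom G ; _≃_ = Groupoid._≈_ G }

record Functor (A B : Groupoid) : Set where
  field
    F₀ : Obj A → Obj B
    F₁ : ∀ {x y} → Hom A x y → Hom B (F₀ x) (F₀ y)

open Functor public

HFib : {A B : Groupoid} → Functor A B → Obj B → GpdData
HFib {A} {B} F b = record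
  { Ob  = Σ (Obj A) (λ x → Hom B (F₀ F x) b)
  ; Mor = λ p q → Σ (Hom A (proj₁ p) (proj₁ q))
                    (λ α → Groupoid._≈_ B (Groupoid._∘_ B (proj₂ q) (F₁ F α)) (proj₂ p))
  ; _≃_ = λ f g → Groupoid._≈_ A (proj₁ f) (proj₁ g)
  }

FiniteAut : (G : GpdData) → GpdData.Ob G → Set
FiniteAut G x = ∃ λ (L : List (GpdData.Mor G x x)) →
  ∀ (f : GpdData.Mor G x x) → Any (λ g → GpdData._≃_ G f g) L

LocallyFiniteGroupoid : GpdData → Set
LocallyFiniteGroupoid G = ∀ x → FiniteAut G x

FiniteGroupoid : GpdData → Set
FiniteGroupoid G =
  (∃ λ (L : List (GpdData.Ob G)) → ∀ x → Any (λ y → GpdData.Mor G x y) L)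
  × LocallyFiniteGroupoid G

Discrete : GpdData → Set
Discrete G = ∀ {x y} (f g : GpdData.Mor G x y) → GpdData._≃_ G f g

data Zigzag {n : ℕ} (R : Fin n → Fin n → Bool) (S : Fin n → Set) : Fin n → Fin n → Set where
  stop : ∀ {x} → S x → Zigzag R S x x
  up   : ∀ {x y z} → S x → T (R x y) → Zigzag R S y z → Zigzag R S x z
  down : ∀ {x y z} → S x → T (R y x) → Zigzag R S y z → Zigzag R S x z

record Poset : Set where
  field
    size      : ℕ
    le        : Fin size → Fin size → Bool
    le-refl   : ∀ x → T (le x x)
    le-trans  : ∀ {x y z} → T (le x y) → T (le y z) → T (le x z)
    le-antisym : ∀ {x y} → T (le x y) → T (le y x) → x ≡ y
    nonempty  : Fin size
    connected : ∀ x y → Zigzag le (λ _ → ⊤) x y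

open Poset public

Cover : (P : Poset) → Fin (size P) → Fin (size P) → Set
Cover P x y = T (le P x y) × ¬ (x ≡ y)
  × (∀ z → T (le P x z) → T (le P z y) → z ≡ x ⊎ z ≡ y)

record Contraction (P Q : Poset) : Set where
  field
    map        : Fin (size P) → Fin (size Q)
    monotone   : ∀ {x y} → T (le P x y) → T (le Q (map x) (map y))
    surjective : ∀ q → ∃ λ x → map x ≡ q
    fibre-convex : ∀ q {x y z} → map x ≡ q → map z ≡ q →
                   T (le P x y) → T (le P y z) → map y ≡ q
    -- fibres are connected (non-emptiness follows from surjectivity)
    fibre-connected : ∀ q {x y} → map x ≡ q → map y ≡ q →
                      Zigzag (le P) (λ z → map z ≡ q) x y
    covers : ∀ {q q'} → Cover Q q q' →
             ∃₂ λ p p' → Cover P p p' × map p ≡ q × map p' ≡ q'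

open Contraction public

record PosetIso (P Q : Poset) : Set where
  field
    fun : Fin (size P) → Fin (size Q)
    inv : Fin (size Q) → Fin (size P)
    inv-fun : ∀ x → inv (fun x) ≡ x
    fun-inv : ∀ y → fun (inv y) ≡ y
    order : ∀ x y → le P x y ≡ le Q (fun x) (fun y)

open PosetIso public

idIso : (P : Poset) → PosetIso P P
idIso P = record { fun = λ x → x ; inv = λ x → x ; inv-fun = λ _ → refl
                 ; fun-inv = λ _ → refl ; order = λ _ _ → refl }

_∘ᵢ_ : ∀ {P Q R} → PosetIso Q R → PosetIso P Q → PosetIso P R
β ∘ᵢ α = record
  { fun = λ x → fun β (fun α x)
  ; inv = λ z → inv α (inv β z)
  ; inv-fun = λ x → trans (cong (inv α) (inv-fun β (fun α x))) (inv-fun α x)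
  ; fun-inv = λ z → trans (cong (fun β) (fun-inv α (inv β z))) (fun-inv β z)
  ; order = λ x y → trans (order α x y) (order β (fun α x) (fun α y))
  }

-- Chains of contractions P = P₀ ↠ P₁ ↠ ⋯ ↠ Pₘ  (m contractions, m+1 posets)

data Chain : Poset → ℕ → Set where
  []  : ∀ {P} → Chain P 0
  _∷_ : ∀ {P Q m} → Contraction P Q → Chain Q m → Chain P (suc m)

data ChainIso : ∀ {P P' m} → Chain P m → Chain P' m → PosetIso P P' → Set where
  nil  : ∀ {P P'} {α : PosetIso P P'} → ChainIso [] [] α
  cons : ∀ {P P' Q Q' m} {f : Contraction P Q} {f' : Contraction P' Q'}
           {c : Chain Q m} {c' : Chain Q' m} {α : PosetIso P P'} {β : PosetIso Q Q'} →
         ChainIso c c' β →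
         (∀ x → fun β (map f x) ≡ map f' (fun α x)) →
         ChainIso (f ∷ c) (f' ∷ c') α

compCI : ∀ {P P' P'' m} {c : Chain P m} {c' : Chain P' m} {c'' : Chain P'' m}
           {α : PosetIso P P'} {α' : PosetIso P' P''} →
         ChainIso c c' α → ChainIso c' c'' α' → ChainIso c c'' (α' ∘ᵢ α)
compCI nil nil = nil
compCI {α = α} {α'} (cons {β = β} r sq) (cons {β = β'} r' sq') =
  cons (compCI r r') (λ x → trans (cong (fun β') (sq x)) (sq' (fun α x)))

ChIsoEq : ∀ {P P' m} {c : Chain P m} {c' : Chain P' m} {α α' : PosetIso P P'} →
          ChainIso c c' α → ChainIso c c' α' → Set
ChIsoEq {α = α} {α'} nil nil = ∀ x → fun α x ≡ fun α' x
ChIsoEq {α = α} {α'} (cons r _) (cons r' _) = (∀ x → fun α x ≡ fun α' x) × ChIsoEq r r'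

-- one component of an object of 𝐊_{m+1}
Elt : ℕ → Set
Elt m = Σ Poset (λ P → Chain P m)

ChainHom : ∀ {m} → Elt m → Elt m → Set
ChainHom (P , c) (P' , c') = Σ (PosetIso P P') (ChainIso c c')

ChainHomEq : ∀ {m} {X Y : Elt m} → ChainHom X Y → ChainHom X Y → Set
ChainHomEq (_ , r) (_ , r') = ChIsoEq r r'

compCH : ∀ {m} {X Y Z : Elt m} → ChainHom Y Z → ChainHom X Y → ChainHom X Z
compCH (β , s) (α , r) = (β ∘ᵢ α) , compCI r s

record Fam (A : Set) : Set where
  field
    card : ℕ
    at   : Fin card → A

open Fam public

record FamHom {m : ℕ} (X Y : Fam (Elt m)) : Set where
  field
    σ    : Fin (card X) → Fin (card Y)
    σ⁻¹  : Fin (card Y) → Fin (card X)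
    σ⁻¹σ : ∀ i → σ⁻¹ (σ i) ≡ i
    σσ⁻¹ : ∀ j → σ (σ⁻¹ j) ≡ j
    comp : ∀ i → ChainHom (at X i) (at Y (σ i))

open FamHom public

FamHomEq : ∀ {m} {X Y : Fam (Elt m)} → FamHom X Y → FamHom X Y → Set
FamHomEq {X = X} {Y} h h' =
  Σ (∀ i → σ h i ≡ σ h' i) λ e →
    ∀ i → ChainHomEq (comp h i)
            (subst (λ j → ChainHom (at X i) (at Y j)) (sym (e i)) (comp h' i))

compFH : ∀ {m} {X Y Z : Fam (Elt m)} → FamHom Y Z → FamHom X Y → FamHom X Z
compFH g h = record
  { σ = λ i → σ g (σ h i)
  ; σ⁻¹ = λ k → σ⁻¹ h (σ⁻¹ g k)
  ; σ⁻¹σ = λ i → trans (cong (σ⁻¹ h) (σ⁻¹σ g (σ h i))) (σ⁻¹σ h i)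
  ; σσ⁻¹ = λ k → trans (cong (σ g) (σσ⁻¹ h (σ⁻¹ g k))) (σσ⁻¹ g k)
  ; comp = λ i → compCH (comp g (σ h i)) (comp h i)
  }

-- K₊ m is 𝐊_{m+1}: finite families of chains of m contractions
-- P₀ ↠ ⋯ ↠ Pₘ of finite connected non-empty posets.

K₊ : ℕ → Groupoid
K₊ m = record
  { Obj = Fam (Elt m)
  ; Hom = FamHom
  ; _≈_ = FamHomEq
  ; _∘_ = compFH
  }

Elt₀ : Set
Elt₀ = Σ Poset (λ P → size P ≡ 1)

incl₀ : Fam Elt₀ → Fam (Elt 0)
incl₀ X = record { card = card X ; at = λ i → proj₁ (at X i) , [] }

K₀ : Groupoid
K₀ = record
  { Obj = Fam Elt₀
  ; Hom = λ X Y → FamHom (incl₀ X) (incl₀ Y)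
  ; _≈_ = FamHomEq
  ; _∘_ = compFH
  }

s₀ : Functor K₀ (K₊ 0)
s₀ = record { F₀ = incl₀ ; F₁ = λ h → h }

keepFirst : (m : ℕ) → Functor (K₊ m) (K₊ 0)
keepFirst m = record
  { F₀ = λ X → record { card = card X ; at = λ i → proj₁ (at X i) , [] }
  ; F₁ = λ h → record
      { σ = σ h ; σ⁻¹ = σ⁻¹ h ; σ⁻¹σ = σ⁻¹σ h ; σσ⁻¹ = σσ⁻¹ h
      ; comp = λ i → proj₁ (comp h i) , nil }
  }

-- d₁ : 𝐊₂ → 𝐊₁ deletes P₁ (for n = 2, d₁ = d_{n-1} deletes P_{n-1})
d₁ : Functor (K₊ 1) (K₊ 0)
d₁ = keepFirst 1

-- the long-edge map 𝐊_{m+1} → 𝐊₁ (composite of inner faces; sends a chain to P₀)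
longEdge : (m : ℕ) → Functor (K₊ m) (K₊ 0)
longEdge m = keepFirst m

𝟙 : Poset
𝟙 = record
  { size = 1 ; le = λ _ _ → true ; le-refl = λ _ → tt ; le-trans = λ _ _ → tt
  ; le-antisym = λ { {zero} {zero} _ _ → refl }
  ; nonempty = zero ; connected = λ { zero zero → stop tt } }

zz-weaken : ∀ {n} {R : Fin n → Fin n → Bool} {S : Fin n → Set} {x y} →
            (∀ z → S z) → Zigzag R (λ _ → ⊤) x y → Zigzag R S x y
zz-weaken all (stop _) = stop (all _)
zz-weaken all (up _ r p) = up (all _) r (zz-weaken all p)
zz-weaken all (down _ r p) = down (all _) r (zz-weaken all p)

idC : (P : Poset) → Contraction P P
idC P = record
  { map = λ x → x
  ; monotone = λ r → r
  ; surjective = λ q → q , refl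
  ; fibre-convex = λ { q {x} {y} {z} ex ez lxy lyz →
      trans (sym (le-antisym P lxy (subst (λ w → T (le P y w)) (trans ez (sym ex)) lyz))) ex }
  ; fibre-connected = λ { q {x} {y} ex ey →
      subst (λ w → Zigzag (le P) (λ z → z ≡ q) x w) (trans ex (sym ey)) (stop ex) }
  ; covers = λ {q} {q'} cv → q , q' , cv , refl , refl
  }

termC : (P : Poset) → Contraction P 𝟙
termC P = record
  { map = λ _ → zero
  ; monotone = λ _ → tt
  ; surjective = λ { zero → nonempty P , refl }
  ; fibre-convex = λ { zero _ _ _ _ → refl }
  ; fibre-connected = λ { zero {x} {y} _ _ → zz-weaken (λ _ → refl) (connected P x y) }
  ; covers = λ { {zero} {zero} (_ , ne , _) → ⊥-elim (ne refl) }
  }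

-- sᵢ on a single chain of m contractions (m+1 posets), i ∈ {0, …, m+1}:
-- for i ≤ m insert an identity at Pᵢ; for i = m+1 append Pₘ ↠ 1
degenChain : ∀ {P m} → Fin (suc (suc m)) → Chain P m → Chain P (suc m)
degenChain {P} zero c = idC P ∷ c
degenChain {P} (suc zero) [] = termC P ∷ []
degenChain (suc i) (f ∷ c) = f ∷ degenChain i c

degen : ∀ {m} → Fin (suc (suc m)) → Fam (Elt m) → Fam (Elt (suc m))
degen i X = record { card = card X
                   ; at = λ j → proj₁ (at X j) , degenChain i (proj₂ (at X j)) }

Degenerate : (m : ℕ) → Obj (K₊ m) → Set
Degenerate zero x = ∃ λ (y : Obj K₀) → Hom (K₊ 0) (F₀ s₀ y) x
Degenerate (suc m) x =
  ∃₂ λ (i : Fin (suc (suc m))) (y : Obj (K₊ m)) → Hom (K₊ (suc m)) (degen i y) x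

KLocallyFinite : Set
KLocallyFinite =
  LocallyFiniteGroupoid (underlying (K₊ 0))
  × (∀ a → FiniteGroupoid (HFib s₀ a))
  × (∀ a → FiniteGroupoid (HFib d₁ a))

KLocallyDiscrete : Set
KLocallyDiscrete =
  (∀ a → Discrete (HFib s₀ a)) × (∀ a → Discrete (HFib d₁ a))

KLocallyFiniteLength : Set
KLocallyFiniteLength =
  ∀ (a : Obj (K₊ 0)) → ∃ λ (N : ℕ) → ∀ m → N ≤ m →
    ¬ (Σ (GpdData.Ob (HFib (longEdge m) a)) λ p → ¬ Degenerate m (proj₁ p))

{-# OPTIONS --safe #-}

-- A morphism of families of chains is determined by its bijection of components and its maps on
-- the bottom posets P₀, since each contraction is surjective.  Over a fixed a ∈ 𝐊₁ both are fixed
-- by the structure map to a, so the fibres of s₀ and d₁ are discrete.  Finiteness is enumeration: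
-- a family of finite posets has finitely many automorphisms, the fibre of s₀ over a has at most one
-- object up to isomorphism, and an object of the fibre of d₁ is determined up to isomorphism by a
-- choice of contraction out of each component of a, of which there are finitely many up to
-- isomorphism.  Finally, a contraction between posets of the same size is an isomorphism (covers
-- lift, and covers generate the order), hence can be absorbed into a degeneracy; so along a
-- non-degenerate simplex over a every level lowers the total size of the family, which bounds the
-- dimension.

module Submission where

open import Defs
open import Data.Nat using (ℕ; zero; suc; _+_; _*_; _≤_; _<_; z≤n; s≤s; +-0-rawMonoid)
open import Data.Nat.Properties
open import Algebra.Definitions.RawMonoid +-0-rawMonoid using (sum)
open import Algebra.Properties.Monoid.Sum +-0-monoid using (sum-cong-≗)
open import Data.Fin as Fin using (Fin; zero; suc; toℕ; punchIn; inject₁)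
import Data.Fin.Properties as Finₚ
open import Data.Bool using (Bool; true; false; T; if_then_else_; _∧_; _∨_)
open import Data.Bool.Properties as Boolₚ using (T-∧; T-∨; T?; T-≡; ⇔→≡)
open import Data.Empty using (⊥-elim)
open import Data.Product using (Σ; ∃; ∃₂; _×_; _,_; proj₁; proj₂)
open import Data.Sum as Sum using (_⊎_; inj₁; inj₂)
import Data.Maybe as Maybe
import Data.Maybe.Relation.Unary.Any as MAny
open import Data.List as List using (List; []; _∷_; allFin; upTo; concatMap; mapMaybe)
open import Data.List.Relation.Unary.Any as Any using (Any; here; there)
import Data.List.Relation.Unary.Any.Properties as Anyₚ
open import Data.List.Membership.Propositional.Properties using (∈-allFin; ∈-upTo⁺)
open import Function using (_∘_; id; Equivalence; mk⇔)
open import Relation.Binary.PropositionalEquality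
open import Relation.Binary.Construct.Closure.ReflexiveTransitive using (Star; ε; _◅_; _◅◅_; fold)
open import Relation.Nullary using (Dec; yes; no; isYes; ¬_)
open import Relation.Nullary.Decidable using (_×-dec_; _⊎-dec_; _→-dec_; ¬?; map′; toWitness; fromWitness; dec⇒maybe)
open import Relation.Unary using (Decidable)
open import Axiom.UniquenessOfIdentityProofs using (module Decidable⇒UIP)

-- Finite enumerations

FiniteUpTo : {A : Set} → (A → A → Set) → Set
FiniteUpTo {A} _~_ = ∃ λ (L : List A) → ∀ x → Any (x ~_) L

consΠ : ∀ {n} {B : Fin (suc n) → Set} → B zero → ((i : Fin n) → B (suc i)) → (i : Fin (suc n)) → B i
consΠ y t zero = y
consΠ y t (suc i) = t i

allΠ : ∀ {n} {B : Fin n → Set} → ((i : Fin n) → List (B i)) → List ((i : Fin n) → B i)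
allΠ {zero} l = (λ ()) ∷ []
allΠ {suc n} l = concatMap (λ y → List.map (consΠ y) (allΠ (l ∘ suc))) (l zero)

allΠ⁺ : ∀ {n} {B : Fin n → Set} {l : (i : Fin n) → List (B i)} (P : (i : Fin n) → B i → Set) →
        (∀ i → Any (P i) (l i)) → Any (λ t → ∀ i → P i (t i)) (allΠ l)
allΠ⁺ {zero} P _ = here (λ ())
allΠ⁺ {suc n} P p = Anyₚ.concatMap⁺ _ (Any.map (λ py → Anyₚ.gmap
  (λ pt → λ { zero → py ; (suc i) → pt i }) (allΠ⁺ (P ∘ suc) (p ∘ suc))) (p zero))

allFunctions : ∀ a b → List (Fin a → Fin b)
allFunctions a b = allΠ (λ _ → allFin b)

allFunctions⁺ : ∀ {a b} (f : Fin a → Fin b) → Any (λ g → ∀ x → f x ≡ g x) (allFunctions a b)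
allFunctions⁺ f = allΠ⁺ (λ i y → f i ≡ y) (λ i → ∈-allFin (f i))

allRelations : ∀ k → List (Fin k → Fin k → Bool)
allRelations k = allΠ (λ _ → allΠ (λ _ → true ∷ false ∷ []))

allRelations⁺ : ∀ {k} (r : Fin k → Fin k → Bool) → Any (λ s → ∀ x y → r x y ≡ s x y) (allRelations k)
allRelations⁺ r = allΠ⁺ _ (λ x → allΠ⁺ (λ y b → r x y ≡ b) (λ y → bool (r x y)))
  where
    bool : ∀ b → Any (b ≡_) (true ∷ false ∷ [])
    bool true = here refl
    bool false = there (here refl)

buildValid : {C D : Set} {V : C → Set} → (∀ c → Dec (V c)) → (∀ c → V c → D) → List C → List D
buildValid V? mk = mapMaybe (λ c → Maybe.map (mk c) (dec⇒maybe (V? c)))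

buildValid⁺ : {C D : Set} {V : C → Set} (V? : ∀ c → Dec (V c)) (mk : ∀ c → V c → D) {Q : D → Set} {cs : List C} →
              Any (λ c → V c × (∀ v → Q (mk c v))) cs → Any Q (buildValid V? mk cs)
buildValid⁺ {V = V} V? mk {Q} p = Anyₚ.mapMaybe⁺ _ _ (Anyₚ.map⁺ (Any.map valid p))
  where
    valid : ∀ {c} → V c × (∀ v → Q (mk c v)) → MAny.Any Q (Maybe.map (mk c) (dec⇒maybe (V? c)))
    valid {c} (v , q) with V? c
    ... | yes v′ = MAny.just (q v′)
    ... | no ¬v = ⊥-elim (¬v v)

sum-mono-≤ : ∀ {k} {f g : Fin k → ℕ} → (∀ i → f i ≤ g i) → sum f ≤ sum g
sum-mono-≤ {zero} _ = z≤n
sum-mono-≤ {suc k} f≤g = +-mono-≤ (f≤g zero) (sum-mono-≤ (f≤g ∘ suc))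

sum-mono-< : ∀ {k} {f g : Fin k → ℕ} → (∀ i → f i ≤ g i) → ∀ j → f j < g j → sum f < sum g
sum-mono-< f≤g zero fj<gj = +-mono-<-≤ fj<gj (sum-mono-≤ (λ i → f≤g (suc i)))
sum-mono-< f≤g (suc j) fj<gj = +-mono-≤-< (f≤g zero) (sum-mono-< (λ i → f≤g (suc i)) j fj<gj)

sum-≤-* : ∀ {k} {f : Fin k → ℕ} {M} → (∀ i → f i ≤ M) → sum f ≤ k * M
sum-≤-* {zero} _ = z≤n
sum-≤-* {suc k} f≤M = +-mono-≤ (f≤M zero) (sum-≤-* (λ i → f≤M (suc i)))

≤-sum : ∀ {k} (f : Fin k → ℕ) i → f i ≤ sum f
≤-sum f zero = m≤m+n _ _
≤-sum f (suc i) = ≤-trans (≤-sum (λ j → f (suc j)) i) (m≤n+m _ (f zero))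

count : ∀ {k} → (Fin k → Bool) → ℕ
count p = sum (λ i → if p i then 1 else 0)

count≤ : ∀ {k} (p : Fin k → Bool) → count p ≤ k
count≤ {k} p = ≤-trans (sum-≤-* (λ i → indicator≤1 (p i))) (≤-reflexive (*-identityʳ k))
  where
    indicator≤1 : ∀ b → (if b then 1 else 0) ≤ 1
    indicator≤1 true = s≤s z≤n
    indicator≤1 false = z≤n

count-mono-< : ∀ {k} {p q : Fin k → Bool} → (∀ i → T (p i) → T (q i)) →
               ∀ j → ¬ T (p j) → T (q j) → count p < count q
count-mono-< {p = p} {q} p⊆q j ¬pj qj = sum-mono-< (λ i → indicator-mono (p⊆q i)) j (indicator-< ¬pj qj)
  where
    indicator-mono : ∀ {a b} → (T a → T b) → (if a then 1 else 0) ≤ (if b then 1 else 0)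
    indicator-mono {false} _ = z≤n
    indicator-mono {true} {true} _ = ≤-refl
    indicator-mono {true} {false} a⇒b = ⊥-elim (a⇒b _)
    indicator-< : ∀ {a b} → ¬ T a → T b → (if a then 1 else 0) < (if b then 1 else 0)
    indicator-< {false} {true} _ _ = s≤s z≤n
    indicator-< {true} ¬a _ = ⊥-elim (¬a _)

Surjection : ∀ {n k} → (Fin n → Fin k) → Set
Surjection {n} {k} f = ∀ q → ∃ λ x → f x ≡ q

surjective⇒≥ : ∀ {n k} {f : Fin n → Fin k} → Surjection f → k ≤ n
surjective⇒≥ {f = f} surj = Finₚ.injective⇒≤ {f = proj₁ ∘ surj}
  (λ {a} {b} e → trans (sym (proj₂ (surj a))) (trans (cong f e) (proj₂ (surj b))))

-- Deleting one point of a fibre with two points would leave a surjection from a smaller set.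
surjective∧≤⇒injective : ∀ {n k} {f : Fin n → Fin k} → Surjection f → n ≤ k →
                         ∀ {a b} → f a ≡ f b → a ≡ b
surjective∧≤⇒injective {suc n} {k} {f} surj n≤k {a} {b} fa≡fb with a Finₚ.≟ b
... | yes a≡b = a≡b
... | no a≢b = ⊥-elim (<-irrefl refl (≤-trans n≤k (surjective⇒≥ restricted-surjective)))
  where
    restricted-surjective : Surjection (λ x → f (punchIn b x))
    restricted-surjective q with surj q
    ... | x , fx≡q with x Finₚ.≟ b
    ... | no x≢b = Fin.punchOut (x≢b ∘ sym) , trans (cong f (Finₚ.punchIn-punchOut (x≢b ∘ sym))) fx≡q
    ... | yes refl = Fin.punchOut (a≢b ∘ sym) ,
                     trans (cong f (Finₚ.punchIn-punchOut (a≢b ∘ sym))) (trans fa≡fb fx≡q)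

-- Deciding zigzag connectivity

_⊆ᵇ_ : ∀ {n} → (Fin n → Bool) → (Fin n → Bool) → Set
p ⊆ᵇ q = ∀ i → T (p i) → T (q i)

increasing-stabilises : ∀ {n} (B : ℕ → Fin n → Bool) → (∀ k → B k ⊆ᵇ B (suc k)) →
                        ∃ λ k → B (suc k) ⊆ᵇ B k
increasing-stabilises {n} B increasing = go 0 (suc n) (m≤n+m (suc n) _)
  where
    -- Each unsuccessful step raises count (B k) and spends one unit of fuel, and count (B k) ≤ n.
    go : ∀ k fuel → n < count (B k) + fuel → ∃ λ k → B (suc k) ⊆ᵇ B k
    go k zero n<c = ⊥-elim (<-irrefl refl (<-≤-trans n<c (≤-trans (≤-reflexive (+-identityʳ _)) (count≤ (B k)))))
    go k (suc fuel) n<c with Finₚ.all? (λ i → T? (B (suc k) i) →-dec T? (B k i))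
    ... | yes closed = k , closed
    ... | no ¬closed with Finₚ.¬∀⟶∃¬ n _ (λ i → T? (B (suc k) i) →-dec T? (B k i)) ¬closed
    ... | i , ¬i⇒ with T? (B (suc k) i)
    ...   | no ¬new = ⊥-elim (¬i⇒ (⊥-elim ∘ ¬new))
    ...   | yes new = go (suc k) fuel (<-≤-trans n<c (≤-trans (≤-reflexive (+-suc _ fuel))
              (+-monoˡ-≤ fuel (count-mono-< (increasing k) i (λ old → ¬i⇒ (λ _ → old)) new))))

-- reach k z: z is joined to y by a zigzag in S with at most k steps
module Reach {n} (R : Fin n → Fin n → Bool) {S : Fin n → Set} (S? : Decidable S) (y : Fin n) where

  Step : (Fin n → Bool) → Fin n → Set
  Step B z = S z × ∃ λ w → (T (R z w) ⊎ T (R w z)) × T (B w)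

  step? : ∀ B z → Dec (Step B z)
  step? B z = S? z ×-dec Finₚ.any? (λ w → (T? (R z w) ⊎-dec T? (R w z)) ×-dec T? (B w))

  reach : ℕ → Fin n → Bool
  reach zero z = isYes (z Finₚ.≟ y) ∧ isYes (S? z)
  reach (suc k) z = reach k z ∨ isYes (step? (reach k) z)

  reach-increasing : ∀ k → reach k ⊆ᵇ reach (suc k)
  reach-increasing k z = Equivalence.from T-∨ ∘ inj₁

  reach-sound : ∀ k z → T (reach k z) → Zigzag R S z y
  reach-sound zero z t with z Finₚ.≟ y | S? z
  ... | yes refl | yes s = stop s
  reach-sound (suc k) z t with Equivalence.to T-∨ t
  ... | inj₁ t′ = reach-sound k z t′
  ... | inj₂ t′ with toWitness {a? = step? (reach k) z} t′
  ...   | s , w , inj₁ r , tw = up s r (reach-sound k w tw)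
  ...   | s , w , inj₂ r , tw = down s r (reach-sound k w tw)

  reach-start : ∀ k → S y → T (reach k y)
  reach-start zero s with y Finₚ.≟ y | S? y
  ... | yes _ | yes _ = _
  ... | no y≢y | _ = y≢y refl
  ... | yes _ | no ¬s = ¬s s
  reach-start (suc k) s = reach-increasing k y (reach-start k s)

  reach-step : ∀ k z → Step (reach k) z → T (reach (suc k) z)
  reach-step k z st = Equivalence.from T-∨ (inj₂ (fromWitness {a? = step? (reach k) z} st))

  reach-complete : ∀ K → reach (suc K) ⊆ᵇ reach K → ∀ {z} → Zigzag R S z y → T (reach K z)
  reach-complete K closed (stop s) = reach-start K s
  reach-complete K closed {z} (up s r p) = closed z (reach-step K z (s , _ , inj₁ r , reach-complete K closed p))
  reach-complete K closed {z} (down s r p) = closed z (reach-step K z (s , _ , inj₂ r , reach-complete K closed p))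

zigzag? : ∀ {n} (R : Fin n → Fin n → Bool) {S : Fin n → Set} → Decidable S → ∀ x y → Dec (Zigzag R S x y)
zigzag? R S? x y = decide (increasing-stabilises reach reach-increasing)
  where
    open Reach R S? y
    decide : ∃ (λ K → reach (suc K) ⊆ᵇ reach K) → Dec (Zigzag R _ x y)
    decide (K , closed) = map′ (reach-sound K x) (reach-complete K closed) (T? (reach K x))

Zigzag-map : ∀ {n n′} {R : Fin n → Fin n → Bool} {S : Fin n → Set}
               {R′ : Fin n′ → Fin n′ → Bool} {S′ : Fin n′ → Set} (h : Fin n → Fin n′) →
             (∀ {a b} → T (R a b) → T (R′ (h a) (h b))) → (∀ {a} → S a → S′ (h a)) →
             ∀ {x y} → Zigzag R S x y → Zigzag R′ S′ (h x) (h y)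
Zigzag-map h hR hS (stop s) = stop (hS s)
Zigzag-map h hR hS (up s r p) = up (hS s) (hR r) (Zigzag-map h hR hS p)
Zigzag-map h hR hS (down s r p) = down (hS s) (hR r) (Zigzag-map h hR hS p)

module _ {P Q : Poset} (α : PosetIso P Q) where

  fun-mono : ∀ {x y} → T (le P x y) → T (le Q (fun α x) (fun α y))
  fun-mono {x} {y} = subst T (order α x y)

  inv-mono : ∀ {a b} → T (le Q a b) → T (le P (inv α a) (inv α b))
  inv-mono {a} {b} a≤b = subst T (sym (order α (inv α a) (inv α b)))
    (subst₂ (λ u v → T (le Q u v)) (sym (fun-inv α a)) (sym (fun-inv α b)) a≤b)

  fun-injective : ∀ {x y} → fun α x ≡ fun α y → x ≡ y
  fun-injective {x} {y} e = trans (sym (inv-fun α x)) (trans (cong (inv α) e) (inv-fun α y))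

  inv-injective : ∀ {a b} → inv α a ≡ inv α b → a ≡ b
  inv-injective {a} {b} e = trans (sym (fun-inv α a)) (trans (cong (fun α) e) (fun-inv α b))

  inv-cover : ∀ {a b} → Cover Q a b → Cover P (inv α a) (inv α b)
  inv-cover {a} {b} (a≤b , a≢b , between) =
    inv-mono a≤b , a≢b ∘ inv-injective , λ z a≤z z≤b →
      Sum.map (transport z) (transport z) (between (fun α z)
        (subst (λ u → T (le Q u (fun α z))) (fun-inv α a) (fun-mono a≤z))
        (subst (λ u → T (le Q (fun α z) u)) (fun-inv α b) (fun-mono z≤b)))
    where
      transport : ∀ z {c} → fun α z ≡ c → z ≡ inv α c
      transport z e = trans (sym (inv-fun α z)) (cong (inv α) e)

PosetIso-sym : ∀ {P Q} → PosetIso P Q → PosetIso Q P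
PosetIso-sym {P} {Q} α = record
  { fun = inv α ; inv = fun α ; inv-fun = fun-inv α ; fun-inv = inv-fun α
  ; order = λ a b → sym (trans (order α (inv α a) (inv α b)) (cong₂ (le Q) (fun-inv α a) (fun-inv α b))) }

PosetIso-size : ∀ {P Q} → PosetIso P Q → size P ≡ size Q
PosetIso-size α = Finₚ.cantor-schröder-bernstein (fun-injective α) (inv-injective α)

precompose : ∀ {P Q R} → PosetIso P Q → Contraction Q R → Contraction P R
precompose {P} α g = record
  { map = map g ∘ fun α
  ; monotone = monotone g ∘ fun-mono α
  ; surjective = λ r → let x , gx≡r = surjective g r in
      inv α x , trans (cong (map g) (fun-inv α x)) gx≡r
  ; fibre-convex = λ q ex ez x≤y y≤z → fibre-convex g q ex ez (fun-mono α x≤y) (fun-mono α y≤z)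
  ; fibre-connected = λ q {x} {y} ex ey →
      subst₂ (Zigzag (le P) _) (inv-fun α x) (inv-fun α y)
        (Zigzag-map (inv α) (inv-mono α) (λ {a} e → trans (cong (map g) (fun-inv α a)) e)
          (fibre-connected g q ex ey))
  ; covers = λ cov → let p , p′ , p⋖p′ , gp , gp′ = covers g cov in
      inv α p , inv α p′ , inv-cover α p⋖p′ ,
      trans (cong (map g) (fun-inv α p)) gp , trans (cong (map g) (fun-inv α p′)) gp′
  }

Between : ∀ {n} → (Fin n → Fin n → Bool) → Fin n → Fin n → Fin n → Set
Between R x y z = T (R x z) → T (R z y) → z ≡ x ⊎ z ≡ y

between? : ∀ {n} (R : Fin n → Fin n → Bool) x y z → Dec (Between R x y z)
between? R x y z = T? (R x z) →-dec T? (R z y) →-dec (z Finₚ.≟ x ⊎-dec z Finₚ.≟ y)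

_⋖[_]_ : ∀ {n} → Fin n → (Fin n → Fin n → Bool) → Fin n → Set
x ⋖[ R ] y = T (R x y) × x ≢ y × (∀ z → Between R x y z)

⋖? : ∀ {n} (R : Fin n → Fin n → Bool) x y → Dec (x ⋖[ R ] y)
⋖? R x y = T? (R x y) ×-dec ¬? (x Finₚ.≟ y) ×-dec Finₚ.all? (between? R x y)

module _ (P : Poset) where

  interval : Fin (size P) → Fin (size P) → Fin (size P) → Bool
  interval x y z = le P x z ∧ le P z y

  ∈-interval : ∀ {x y z} → T (le P x z) → T (le P z y) → T (interval x y z)
  ∈-interval x≤z z≤y = Equivalence.from T-∧ (x≤z , z≤y)

  ¬cover⇒strictlyBetween : ∀ {x y} → ¬ Cover P x y → T (le P x y) → x ≢ y →
                           ∃ λ z → T (le P x z) × T (le P z y) × z ≢ x × z ≢ y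
  ¬cover⇒strictlyBetween {x} {y} ¬cov x≤y x≢y
    with Finₚ.¬∀⟶∃¬ (size P) _ (between? (le P) x y) (λ btw → ¬cov (x≤y , x≢y , btw))
  ... | z , ¬btw with T? (le P x z) | T? (le P z y) | z Finₚ.≟ x | z Finₚ.≟ y
  ... | no ¬x≤z | _ | _ | _ = ⊥-elim (¬btw (⊥-elim ∘ ¬x≤z))
  ... | yes _ | no ¬z≤y | _ | _ = ⊥-elim (¬btw (λ _ → ⊥-elim ∘ ¬z≤y))
  ... | yes _ | yes _ | yes z≡x | _ = ⊥-elim (¬btw (λ _ _ → inj₁ z≡x))
  ... | yes _ | yes _ | no _ | yes z≡y = ⊥-elim (¬btw (λ _ _ → inj₂ z≡y))
  ... | yes x≤z | yes z≤y | no z≢x | no z≢y = z , x≤z , z≤y , z≢x , z≢y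

  -- Recursion on the size of the interval [x, y], which shrinks when it is split at an inner point.
  ≤⇒Cover* : ∀ {x y} → T (le P x y) → Star (Cover P) x y
  ≤⇒Cover* {x} {y} = go (suc (count (interval x y))) ≤-refl
    where
      go : ∀ fuel {x y} → count (interval x y) < fuel → T (le P x y) → Star (Cover P) x y
      go (suc fuel) {x} {y} small x≤y with x Finₚ.≟ y | ⋖? (le P) x y
      ... | yes refl | _ = ε
      ... | no _ | yes x⋖y = x⋖y ◅ ε
      ... | no x≢y | no ¬x⋖y with ¬cover⇒strictlyBetween ¬x⋖y x≤y x≢y
      ... | z , x≤z , z≤y , z≢x , z≢y =
            go fuel (<-≤-trans left-smaller (≤-pred small)) x≤z ◅◅
            go fuel (<-≤-trans right-smaller (≤-pred small)) z≤y
        where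
          left-smaller : count (interval x z) < count (interval x y)
          left-smaller = count-mono-<
            (λ w w∈ → let x≤w , w≤z = Equivalence.to T-∧ w∈ in ∈-interval x≤w (le-trans P w≤z z≤y)) y
            (λ y∈ → z≢y (le-antisym P z≤y (proj₂ (Equivalence.to T-∧ y∈))))
            (∈-interval x≤y (le-refl P y))
          right-smaller : count (interval z y) < count (interval x y)
          right-smaller = count-mono-<
            (λ w w∈ → let z≤w , w≤y = Equivalence.to T-∧ w∈ in ∈-interval (le-trans P x≤z z≤w) w≤y) x
            (λ x∈ → z≢x (le-antisym P (proj₁ (Equivalence.to T-∧ x∈)) x≤z))
            (∈-interval (le-refl P x) x≤y)

module _ {P Q : Poset} (f : Contraction P Q) (size≤ : size P ≤ size Q) where

  private
    section : Fin (size Q) → Fin (size P)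
    section = proj₁ ∘ surjective f

    section-map : ∀ x → section (map f x) ≡ x
    section-map x = surjective∧≤⇒injective (surjective f) size≤ (proj₂ (surjective f (map f x)))

    cover-reflected : ∀ {q q′} → Cover Q q q′ → T (le P (section q) (section q′))
    cover-reflected cov with covers f cov
    ... | p , p′ , (p≤p′ , _) , refl , refl =
          subst₂ (λ u v → T (le P u v)) (sym (section-map p)) (sym (section-map p′)) p≤p′

    reflects : ∀ {x y} → T (le Q (map f x) (map f y)) → T (le P x y)
    reflects {x} {y} fx≤fy = subst₂ (λ u v → T (le P u v)) (section-map x) (section-map y)
      (fold (λ q q′ → T (le P (section q) (section q′))) (le-trans P ∘ cover-reflected) (le-refl P _)
        (≤⇒Cover* Q fx≤fy))

  contraction-iso : PosetIso P Q
  contraction-iso = record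
    { fun = map f ; inv = section ; inv-fun = section-map ; fun-inv = proj₂ ∘ surjective f
    ; order = λ x y → ⇔→≡ {z = true} (mk⇔ (Equivalence.to T-≡ ∘ monotone f ∘ Equivalence.from T-≡)
                                           (Equivalence.to T-≡ ∘ reflects ∘ Equivalence.from T-≡)) }

-- Contractions out of a finite poset

module ContractionsFrom (A : Poset) where

  ContractionFrom : Set
  ContractionFrom = Σ Poset (Contraction A)

  _≅_ : ContractionFrom → ContractionFrom → Set
  (Q , f) ≅ (Q′ , g) = Σ (PosetIso Q Q′) λ β → ∀ x → fun β (map f x) ≡ map g x

  private
    s : ℕ
    s = size A

    record Valid (k : ℕ) (r : Fin k → Fin k → Bool) (m : Fin s → Fin k) : Set where
      field
        reflexive : ∀ x → T (r x x)
        transitive : ∀ x y z → T (r x y) → T (r y z) → T (r x z)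
        antisymmetric : ∀ x y → T (r x y) → T (r y x) → x ≡ y
        monotone′ : ∀ x y → T (le A x y) → T (r (m x) (m y))
        surjective′ : ∀ q → ∃ λ x → m x ≡ q
        fibre-convex′ : ∀ q x y z → m x ≡ q → m z ≡ q → T (le A x y) → T (le A y z) → m y ≡ q
        fibre-connected′ : ∀ q x y → m x ≡ q → m y ≡ q → Zigzag (le A) (λ z → m z ≡ q) x y
        covers′ : ∀ q q′ → q ⋖[ r ] q′ → ∃₂ λ p p′ → Cover A p p′ × m p ≡ q × m p′ ≡ q′

    valid? : ∀ k r m → Dec (Valid k r m)
    valid? k r m = map′
      (λ (a , b , c , d , e , f , g , h) → record
        { reflexive = a ; transitive = b ; antisymmetric = c ; monotone′ = d ; surjective′ = e
        ; fibre-convex′ = f ; fibre-connected′ = g ; covers′ = h })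
      (λ v → let open Valid v in
        reflexive , transitive , antisymmetric , monotone′ , surjective′ ,
        fibre-convex′ , fibre-connected′ , covers′)
      (Finₚ.all? (λ x → T? (r x x)) ×-dec
       all₃ (λ x y z → T? (r x y) →-dec T? (r y z) →-dec T? (r x z)) ×-dec
       all₂ (λ x y → T? (r x y) →-dec T? (r y x) →-dec x Finₚ.≟ y) ×-dec
       all₂ (λ x y → T? (le A x y) →-dec T? (r (m x) (m y))) ×-dec
       Finₚ.all? (λ q → Finₚ.any? λ x → m x Finₚ.≟ q) ×-dec
       all₄ (λ q x y z → m x Finₚ.≟ q →-dec m z Finₚ.≟ q →-dec T? (le A x y) →-dec T? (le A y z) →-dec
                         m y Finₚ.≟ q) ×-dec
       all₃ (λ q x y → m x Finₚ.≟ q →-dec m y Finₚ.≟ q →-dec zigzag? (le A) (λ z → m z Finₚ.≟ q) x y) ×-dec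
       all₂ (λ q q′ → ⋖? r q q′ →-dec Finₚ.any? λ p → Finₚ.any? λ p′ →
               ⋖? (le A) p p′ ×-dec m p Finₚ.≟ q ×-dec m p′ Finₚ.≟ q′))
      where
        all₂ : ∀ {a b} {P : Fin a → Fin b → Set} → (∀ x y → Dec (P x y)) → Dec (∀ x y → P x y)
        all₂ P? = Finₚ.all? λ x → Finₚ.all? (P? x)
        all₃ : ∀ {a b c} {P : Fin a → Fin b → Fin c → Set} → (∀ x y z → Dec (P x y z)) → Dec (∀ x y z → P x y z)
        all₃ P? = Finₚ.all? λ x → all₂ (P? x)
        all₄ : ∀ {a b c d} {P : Fin a → Fin b → Fin c → Fin d → Set} →
               (∀ x y z w → Dec (P x y z w)) → Dec (∀ x y z w → P x y z w)
        all₄ P? = Finₚ.all? λ x → all₃ (P? x)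

    toContraction : ∀ {k r m} → Valid k r m → ContractionFrom
    toContraction {k} {r} {m} v = Q , record
      { map = m ; monotone = monotone′ _ _ ; surjective = surjective′
      ; fibre-convex = λ q → fibre-convex′ q _ _ _
      ; fibre-connected = λ q → fibre-connected′ q _ _
      ; covers = covers′ _ _ }
      where
        open Valid v
        Q : Poset
        Q = record
          { size = k ; le = r ; le-refl = reflexive ; le-trans = transitive _ _ _
          ; le-antisym = antisymmetric _ _ ; nonempty = m (nonempty A)
          ; connected = λ x y → subst₂ (Zigzag r _) (proj₂ (surjective′ x)) (proj₂ (surjective′ y))
              (Zigzag-map m (monotone′ _ _) id (connected A (proj₁ (surjective′ x)) (proj₁ (surjective′ y)))) }

    contraction-valid : ∀ {Q} (f : Contraction A Q) {r m} → (∀ x y → le Q x y ≡ r x y) → (∀ x → map f x ≡ m x) →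
                        Valid (size Q) r m
    contraction-valid {Q} f {r} {m} le≗r f≗m = record
      { reflexive = to ∘ le-refl Q
      ; transitive = λ _ _ _ a b → to (le-trans Q (from a) (from b))
      ; antisymmetric = λ _ _ a b → le-antisym Q (from a) (from b)
      ; monotone′ = λ x y → subst₂ (λ u v → T (r u v)) (f≗m x) (f≗m y) ∘ to ∘ monotone f
      ; surjective′ = λ q → let x , fx≡q = surjective f q in x , trans (sym (f≗m x)) fx≡q
      ; fibre-convex′ = λ q x y z mx mz a b →
          trans (sym (f≗m y)) (fibre-convex f q (trans (f≗m x) mx) (trans (f≗m z) mz) a b)
      ; fibre-connected′ = λ q x y mx my → Zigzag-map id id (λ {a} e → trans (sym (f≗m a)) e)
          (fibre-connected f q (trans (f≗m x) mx) (trans (f≗m y) my))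
      ; covers′ = λ q q′ (q≤q′ , q≢q′ , btw) →
          let p , p′ , p⋖p′ , fp , fp′ = covers f (from q≤q′ , q≢q′ , λ z a b → btw z (to a) (to b)) in
          p , p′ , p⋖p′ , trans (sym (f≗m p)) fp , trans (sym (f≗m p′)) fp′
      }
      where
        to : ∀ {x y} → T (le Q x y) → T (r x y)
        to {x} {y} = subst T (le≗r x y)
        from : ∀ {x y} → T (r x y) → T (le Q x y)
        from {x} {y} = subst T (sym (le≗r x y))

    Candidate : Set
    Candidate = Σ ℕ λ k → (Fin k → Fin k → Bool) × (Fin s → Fin k)

    candidates : List Candidate
    candidates = concatMap (λ k → concatMap (λ r → List.map (λ m → k , r , m) (allFunctions s k))
                                            (allRelations k))
                           (upTo (suc s))

    ValidCandidate : Candidate → Set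
    ValidCandidate (k , r , m) = Valid k r m

    validCandidate? : ∀ c → Dec (ValidCandidate c)
    validCandidate? (k , r , m) = valid? k r m

    build : ∀ c → ValidCandidate c → ContractionFrom
    build (k , r , m) = toContraction

    candidates⁺ : ∀ {Q} (f : Contraction A Q) →
                  Any (λ c → ValidCandidate c × (∀ v → (Q , f) ≅ build c v)) candidates
    candidates⁺ {Q} f =
      Anyₚ.concatMap⁺ _ (Any.map with-size (∈-upTo⁺ (s≤s (surjective⇒≥ (surjective f)))))
      where
        same : ∀ {r m} (le≗r : ∀ x y → le Q x y ≡ r x y) → (∀ x → map f x ≡ m x) →
               ValidCandidate (size Q , r , m) × (∀ v → (Q , f) ≅ toContraction v)
        same le≗r f≗m = contraction-valid f le≗r f≗m , λ _ →
          record { fun = id ; inv = id ; inv-fun = λ _ → refl ; fun-inv = λ _ → refl ; order = le≗r } , f≗m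
        with-size : ∀ {k} → size Q ≡ k → Any (λ c → ValidCandidate c × (∀ v → (Q , f) ≅ build c v))
                      (concatMap (λ r → List.map (λ m → k , r , m) (allFunctions s k)) (allRelations k))
        with-size refl = Anyₚ.concatMap⁺ _
          (Any.map (λ le≗r → Anyₚ.gmap (same le≗r) (allFunctions⁺ (map f))) (allRelations⁺ (le Q)))

  contractions-finite : FiniteUpTo _≅_
  contractions-finite = buildValid validCandidate? build candidates ,
                        λ (Q , f) → buildValid⁺ validCandidate? build (candidates⁺ f)

ChainIso₀ : ∀ {P P′} {c : Chain P 0} {c′ : Chain P′ 0} (α : PosetIso P P′) → ChainIso c c′ α
ChainIso₀ {c = []} {[]} α = nil

-- Each level of a chain isomorphism is forced by the one below, the contractions being surjective.
ChainIso-determined : ∀ {P P′ m} {c : Chain P m} {c′ : Chain P′ m} {α α′ : PosetIso P P′}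
                      (r : ChainIso c c′ α) (r′ : ChainIso c c′ α′) →
                      (∀ x → fun α x ≡ fun α′ x) → ChIsoEq r r′
ChainIso-determined nil nil α≗α′ = α≗α′
ChainIso-determined {α = α} {α′} (cons {f = f} {f′} {β = β} r sq) (cons {β = β′} r′ sq′) α≗α′ =
  α≗α′ , ChainIso-determined r r′ β≗β′
  where
    β≗β′ : ∀ y → fun β y ≡ fun β′ y
    β≗β′ y with surjective f y
    ... | x , refl = begin
      fun β (map f x)     ≡⟨ sq x ⟩
      map f′ (fun α x)    ≡⟨ cong (map f′) (α≗α′ x) ⟩
      map f′ (fun α′ x)   ≡⟨ sq′ x ⟨
      fun β′ (map f x)    ∎
      where open ≡-Reasoning

ChIsoEq-head : ∀ {P P′ m} {c : Chain P m} {c′ : Chain P′ m} {α α′ : PosetIso P P′}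
               (r : ChainIso c c′ α) (r′ : ChainIso c c′ α′) → ChIsoEq r r′ → ∀ x → fun α x ≡ fun α′ x
ChIsoEq-head nil nil eq = eq
ChIsoEq-head (cons _ _) (cons _ _) eq = proj₁ eq

σ-injective : ∀ {m} {X Y : Fam (Elt m)} (h : FamHom X Y) {i j} → σ h i ≡ σ h j → i ≡ j
σ-injective h {i} {j} e = trans (sym (σ⁻¹σ h i)) (trans (cong (σ⁻¹ h) e) (σ⁻¹σ h j))

-- The level-0 maps of h and h′ at i land in the components σ h i and σ h′ i, which are only
-- propositionally equal; comparing images through toℕ avoids transporting along that equality.
record _≈ₚ_ {m} {X Y : Fam (Elt m)} (h h′ : FamHom X Y) : Set where
  constructor _,_
  field
    σ-≡ : ∀ i → σ h i ≡ σ h′ i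
    fun-≡ : ∀ i (x : Fin (size (proj₁ (at X i)))) →
            toℕ (fun (proj₁ (comp h i)) x) ≡ toℕ (fun (proj₁ (comp h′ i)) x)

≈ₚ-sym : ∀ {m} {X Y : Fam (Elt m)} {h h′ : FamHom X Y} → h ≈ₚ h′ → h′ ≈ₚ h
≈ₚ-sym (σ≗ , fun≗) = (λ i → sym (σ≗ i)) , λ i x → sym (fun≗ i x)

≈ₚ-trans : ∀ {m} {X Y : Fam (Elt m)} {h h′ h″ : FamHom X Y} → h ≈ₚ h′ → h′ ≈ₚ h″ → h ≈ₚ h″
≈ₚ-trans (σ≗ , fun≗) (σ≗′ , fun≗′) = (λ i → trans (σ≗ i) (σ≗′ i)) , λ i x → trans (fun≗ i x) (fun≗′ i x)

≈ₚ⇒≈ : ∀ {m} {X Y : Fam (Elt m)} {h h′ : FamHom X Y} → h ≈ₚ h′ → FamHomEq h h′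
≈ₚ⇒≈ {Y = Y} {h} {h′} (σ≗ , fun≗) = σ≗ , λ i → agree (σ≗ i) (comp h i) (comp h′ i) (fun≗ i)
  where
    agree : ∀ {A j j′} (e : j ≡ j′) (d : ChainHom A (at Y j)) (d′ : ChainHom A (at Y j′)) →
            (∀ x → toℕ (fun (proj₁ d) x) ≡ toℕ (fun (proj₁ d′) x)) →
            ChainHomEq d (subst (λ k → ChainHom A (at Y k)) (sym e) d′)
    agree refl (_ , r) (_ , r′) fun≗ = ChainIso-determined r r′ (Finₚ.toℕ-injective ∘ fun≗)

≈⇒≈ₚ : ∀ {m} {X Y : Fam (Elt m)} {h h′ : FamHom X Y} → FamHomEq h h′ → h ≈ₚ h′
≈⇒≈ₚ {Y = Y} {h} {h′} (σ≗ , eq) = σ≗ , λ i → agree (σ≗ i) (comp h i) (comp h′ i) (eq i)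
  where
    agree : ∀ {A j j′} (e : j ≡ j′) (d : ChainHom A (at Y j)) (d′ : ChainHom A (at Y j′)) →
            ChainHomEq d (subst (λ k → ChainHom A (at Y k)) (sym e) d′) →
            ∀ x → toℕ (fun (proj₁ d) x) ≡ toℕ (fun (proj₁ d′) x)
    agree refl (_ , r) (_ , r′) eq x = cong toℕ (ChIsoEq-head r r′ eq x)

≈ₚ-cancelˡ : ∀ {m} {X Y Z : Fam (Elt m)} (ψ : FamHom Y Z) {h h′ : FamHom X Y} →
             compFH ψ h ≈ₚ compFH ψ h′ → h ≈ₚ h′
≈ₚ-cancelˡ {Y = Y} ψ (σ≗ , fun≗) = σ-injective ψ ∘ σ≗ , λ i x → cancel (σ-injective ψ (σ≗ i)) _ _ (fun≗ i x)
  where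
    cancel : ∀ {j j′} (e : j ≡ j′) (y : Fin (size (proj₁ (at Y j)))) (y′ : Fin (size (proj₁ (at Y j′)))) →
             toℕ (fun (proj₁ (comp ψ j)) y) ≡ toℕ (fun (proj₁ (comp ψ j′)) y′) → toℕ y ≡ toℕ y′
    cancel refl y y′ = cong toℕ ∘ fun-injective (proj₁ (comp ψ _)) ∘ Finₚ.toℕ-injective

fibre-maps-unique : ∀ {X Y Z : Fam (Elt 0)} (ψ : FamHom Y Z) (φ : FamHom X Z) {h h′ : FamHom X Y} →
                    FamHomEq (compFH ψ h) φ → FamHomEq (compFH ψ h′) φ → h ≈ₚ h′
fibre-maps-unique ψ φ ψh≈φ ψh′≈φ = ≈ₚ-cancelˡ ψ (≈ₚ-trans {h′ = φ} (≈⇒≈ₚ ψh≈φ) (≈ₚ-sym (≈⇒≈ₚ ψh′≈φ)))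

keepFirst-reflects-≈ₚ : ∀ {m} {X Y : Fam (Elt m)} {h h′ : FamHom X Y} →
                        F₁ (keepFirst m) h ≈ₚ F₁ (keepFirst m) h′ → h ≈ₚ h′
keepFirst-reflects-≈ₚ (σ≗ , fun≗) = σ≗ , fun≗

keepFirst-fibre-discrete : ∀ m a → Discrete (HFib (keepFirst m) a)
keepFirst-fibre-discrete m a {_ , φ} {_ , ψ} (h , ψh≈φ) (h′ , ψh′≈φ) =
  ≈ₚ⇒≈ (keepFirst-reflects-≈ₚ (fibre-maps-unique ψ φ {F₁ (keepFirst m) h} {F₁ (keepFirst m) h′} ψh≈φ ψh′≈φ))

s₀-fibre-discrete : ∀ a → Discrete (HFib s₀ a)
s₀-fibre-discrete a {_ , φ} {_ , ψ} (h , ψh≈φ) (h′ , ψh′≈φ) = ≈ₚ⇒≈ (fibre-maps-unique ψ φ {h} {h′} ψh≈φ ψh′≈φ)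

-- Local finiteness and discreteness

module _ (P Q : Poset) where

  private
    IsoCandidate : Set
    IsoCandidate = (Fin (size P) → Fin (size Q)) × (Fin (size Q) → Fin (size P))

    IsIso : IsoCandidate → Set
    IsIso (f , g) = (∀ x → g (f x) ≡ x) × (∀ y → f (g y) ≡ y) × (∀ x y → le P x y ≡ le Q (f x) (f y))

    isIso? : ∀ c → Dec (IsIso c)
    isIso? (f , g) = Finₚ.all? (λ x → g (f x) Finₚ.≟ x) ×-dec Finₚ.all? (λ y → f (g y) Finₚ.≟ y) ×-dec
                     Finₚ.all? (λ x → Finₚ.all? λ y → le P x y Boolₚ.≟ le Q (f x) (f y))

    toIso : ∀ c → IsIso c → PosetIso P Q
    toIso (f , g) (gf , fg , order) =
      record { fun = f ; inv = g ; inv-fun = gf ; fun-inv = fg ; order = order }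

    isoCandidates : List IsoCandidate
    isoCandidates = concatMap (λ f → List.map (f ,_) (allFunctions _ _)) (allFunctions _ _)

    isoCandidates⁺ : (α : PosetIso P Q) →
                     Any (λ c → IsIso c × (∀ v → ∀ x → fun α x ≡ fun (toIso c v) x)) isoCandidates
    isoCandidates⁺ α = Anyₚ.concatMap⁺ _ (Any.map (λ {f} α≗f → Anyₚ.gmap (λ {g} α⁻¹≗g →
        ( (λ x → begin
            g (f x)             ≡⟨ cong g (α≗f x) ⟨
            g (fun α x)         ≡⟨ α⁻¹≗g (fun α x) ⟨
            inv α (fun α x)     ≡⟨ inv-fun α x ⟩
            x                   ∎)
        , (λ y → begin
            f (g y)             ≡⟨ cong f (α⁻¹≗g y) ⟨
            f (inv α y)         ≡⟨ α≗f (inv α y) ⟨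
            fun α (inv α y)     ≡⟨ fun-inv α y ⟩
            y                   ∎)
        , λ x y → trans (order α x y) (cong₂ (le Q) (α≗f x) (α≗f y)) )
        , λ _ → α≗f)
      (allFunctions⁺ (inv α))) (allFunctions⁺ (fun α)))
      where open ≡-Reasoning

  PosetIso-finite : FiniteUpTo {PosetIso P Q} (λ α β → ∀ x → fun α x ≡ fun β x)
  PosetIso-finite = buildValid isIso? toIso isoCandidates , λ α → buildValid⁺ isIso? toIso (isoCandidates⁺ α)

module _ (X Y : Fam (Elt 0)) where

  private
    A : Fin (card X) → Poset
    A i = proj₁ (at X i)

    B : Fin (card Y) → Poset
    B j = proj₁ (at Y j)

    isos : ∀ i j → List (PosetIso (A i) (B j))
    isos i j = proj₁ (PosetIso-finite (A i) (B j))

    isos⁺ : ∀ i {j j′} → j ≡ j′ → (α : PosetIso (A i) (B j)) →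
            Any (λ β → ∀ x → toℕ (fun α x) ≡ toℕ (fun β x)) (isos i j′)
    isos⁺ i refl α = Any.map (λ α≗β x → cong toℕ (α≗β x)) (proj₂ (PosetIso-finite (A i) (B _)) α)

    HomCandidate : Set
    HomCandidate = Σ (Fin (card X) → Fin (card Y)) λ s →
                  (Fin (card Y) → Fin (card X)) × ((i : Fin (card X)) → PosetIso (A i) (B (s i)))

    IsBijection : HomCandidate → Set
    IsBijection (s , s⁻¹ , _) = (∀ i → s⁻¹ (s i) ≡ i) × (∀ j → s (s⁻¹ j) ≡ j)

    isBijection? : ∀ c → Dec (IsBijection c)
    isBijection? (s , s⁻¹ , _) = Finₚ.all? (λ i → s⁻¹ (s i) Finₚ.≟ i) ×-dec Finₚ.all? (λ j → s (s⁻¹ j) Finₚ.≟ j)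

    toFamHom : ∀ c → IsBijection c → FamHom X Y
    toFamHom (s , s⁻¹ , t) (s⁻¹s , ss⁻¹) = record
      { σ = s ; σ⁻¹ = s⁻¹ ; σ⁻¹σ = s⁻¹s ; σσ⁻¹ = ss⁻¹ ; comp = λ i → t i , ChainIso₀ (t i) }

    homCandidates : List HomCandidate
    homCandidates = concatMap (λ s → concatMap (λ s⁻¹ → List.map (λ t → s , s⁻¹ , t) (allΠ (λ i → isos i (s i))))
                                               (allFunctions _ _))
                              (allFunctions _ _)

    homCandidates⁺ : (h : FamHom X Y) →
                     Any (λ c → IsBijection c × (∀ v → FamHomEq h (toFamHom c v))) homCandidates
    homCandidates⁺ h = Anyₚ.concatMap⁺ _ (Any.map (λ {s} σ≗s → Anyₚ.concatMap⁺ _ (Any.map (λ {s⁻¹} σ⁻¹≗s⁻¹ →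
        Anyₚ.gmap (λ comp≗t →
          ( (λ i → trans (cong s⁻¹ (sym (σ≗s i))) (trans (sym (σ⁻¹≗s⁻¹ (σ h i))) (σ⁻¹σ h i)))
          , (λ j → trans (cong s (sym (σ⁻¹≗s⁻¹ j))) (trans (sym (σ≗s (σ⁻¹ h j))) (σσ⁻¹ h j))) )
          , λ v → ≈ₚ⇒≈ {h = h} {toFamHom _ v} (σ≗s , comp≗t))
        (allΠ⁺ _ (λ i → isos⁺ i (σ≗s i) (proj₁ (comp h i)))))
      (allFunctions⁺ (σ⁻¹ h)))) (allFunctions⁺ (σ h)))

  FamHom-finite : FiniteUpTo {FamHom X Y} FamHomEq
  FamHom-finite = buildValid isBijection? toFamHom homCandidates ,
                  λ h → buildValid⁺ isBijection? toFamHom (homCandidates⁺ h)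

K₁-locallyFinite : LocallyFiniteGroupoid (underlying (K₊ 0))
K₁-locallyFinite X = FamHom-finite X X

discrete⇒locallyFinite : (G : GpdData) → (∀ x → GpdData.Mor G x x) → Discrete G → LocallyFiniteGroupoid G
discrete⇒locallyFinite G identity discrete x = identity x ∷ [] , λ f → here (discrete f (identity x))

idChainIso : ∀ {P m} (c : Chain P m) → ChainIso c c (idIso P)
idChainIso [] = nil
idChainIso (f ∷ c) = cons (idChainIso c) (λ _ → refl)

idFamHom : ∀ {m} (X : Fam (Elt m)) → FamHom X X
idFamHom X = record { σ = id ; σ⁻¹ = id ; σ⁻¹σ = λ _ → refl ; σσ⁻¹ = λ _ → refl
                    ; comp = λ i → idIso _ , idChainIso _ }

keepFirst-fibre-locallyFinite : ∀ m a → LocallyFiniteGroupoid (HFib (keepFirst m) a)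
keepFirst-fibre-locallyFinite m a = discrete⇒locallyFinite (HFib (keepFirst m) a)
  (λ (X , φ) → idFamHom X ,
                ≈ₚ⇒≈ {h = compFH φ (F₁ (keepFirst m) (idFamHom X))} {φ} ((λ _ → refl) , λ _ _ → refl))
  (λ {p} {q} → keepFirst-fibre-discrete m a {p} {q})

s₀-fibre-locallyFinite : ∀ a → LocallyFiniteGroupoid (HFib s₀ a)
s₀-fibre-locallyFinite a = discrete⇒locallyFinite (HFib s₀ a)
  (λ (x , φ) → idFamHom (incl₀ x) ,
                ≈ₚ⇒≈ {h = compFH φ (idFamHom (incl₀ x))} {φ} ((λ _ → refl) , λ _ _ → refl))
  (λ {p} {q} → s₀-fibre-discrete a {p} {q})

s₀-fibre-classes : ∀ a → FiniteUpTo (GpdData.Mor (HFib s₀ a))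
s₀-fibre-classes a with Finₚ.all? (λ j → size (proj₁ (at a j)) ≟ 1)
... | yes singletons = (a₀ , ψ₀) ∷ [] , λ (x , φ) → here (to-a₀ x φ)
  where
    a₀ : Fam Elt₀
    a₀ = record { card = card a ; at = λ j → proj₁ (at a j) , singletons j }

    ψ₀ : FamHom (incl₀ a₀) a
    ψ₀ = record { σ = id ; σ⁻¹ = id ; σ⁻¹σ = λ _ → refl ; σσ⁻¹ = λ _ → refl
                ; comp = λ j → idIso _ , ChainIso₀ _ }

    to-a₀ : ∀ x (φ : FamHom (incl₀ x) a) → GpdData.Mor (HFib s₀ a) (x , φ) (a₀ , ψ₀)
    to-a₀ x φ = α , ≈ₚ⇒≈ {h = compFH ψ₀ α} {φ} ((λ _ → refl) , λ _ _ → refl)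
      where
        α : FamHom (incl₀ x) (incl₀ a₀)
        α = record { σ = σ φ ; σ⁻¹ = σ⁻¹ φ ; σ⁻¹σ = σ⁻¹σ φ ; σσ⁻¹ = σσ⁻¹ φ
                   ; comp = λ i → proj₁ (comp φ i) , ChainIso₀ _ }
... | no ¬singletons = [] , λ (x , φ) → ⊥-elim (¬singletons (singleton {x} φ))
  where
    singleton : ∀ {x} (φ : FamHom (incl₀ x) a) j → size (proj₁ (at a j)) ≡ 1
    singleton {x} φ j = subst (λ k → size (proj₁ (at a k)) ≡ 1) (σσ⁻¹ φ j)
      (trans (sym (PosetIso-size (proj₁ (comp φ (σ⁻¹ φ j))))) (proj₂ (at x (σ⁻¹ φ j))))

single : ∀ {P} → Chain P 1 → ContractionsFrom.ContractionFrom P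
single (f ∷ []) = _ , f

ChainIso₁ : ∀ {P A Q} {α : PosetIso P A} (c : Chain P 1) {g : Contraction A Q} →
            (β : PosetIso (proj₁ (single c)) Q) → (∀ u → fun β (map (proj₂ (single c)) u) ≡ map g (fun α u)) →
            ChainIso c (g ∷ []) α
ChainIso₁ (f ∷ []) β square = cons {β = β} nil square

module d₁-Fibre (a : Fam (Elt 0)) where

  private
    A : Fin (card a) → Poset
    A j = proj₁ (at a j)

    module C (j : Fin (card a)) = ContractionsFrom (A j)

    Choice : Set
    Choice = (j : Fin (card a)) → C.ContractionFrom j

    object : Choice → GpdData.Ob (HFib d₁ a)
    object t = record { card = card a ; at = λ j → A j , (proj₂ (t j) ∷ []) } ,
               record { σ = id ; σ⁻¹ = id ; σ⁻¹σ = λ _ → refl ; σσ⁻¹ = λ _ → refl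
                      ; comp = λ j → idIso _ , ChainIso₀ _ }

    objects : List (GpdData.Ob (HFib d₁ a))
    objects = List.map object (allΠ (proj₁ ∘ C.contractions-finite))

    module _ (Y : Fam (Elt 1)) (φ : FamHom (F₀ d₁ Y) a) where

      P : Fin (card Y) → Poset
      P c = proj₁ (at Y c)

      Q : Fin (card Y) → Poset
      Q c = proj₁ (single (proj₂ (at Y c)))

      f : ∀ c → Contraction (P c) (Q c)
      f c = proj₂ (single (proj₂ (at Y c)))

      α : ∀ c → PosetIso (P c) (A (σ φ c))
      α c = proj₁ (comp φ c)

      transported : ∀ c → C.ContractionFrom (σ φ c)
      transported c = Q c , precompose (PosetIso-sym (α c)) (f c)

      Matches : ∀ c {j} → σ φ c ≡ j → C.ContractionFrom j → Set
      Matches c {j} e t = C._≅_ j (subst C.ContractionFrom e (transported c)) t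

      Fits : ∀ j → C.ContractionFrom j → Set
      Fits j t = ∀ c (e : σ φ c ≡ j) → Matches c e t

      -- The only component over j is σ⁻¹ j, and equality proofs in Fin are unique.
      fits : ∀ j {t} → Matches (σ⁻¹ φ j) (σσ⁻¹ φ j) t → Fits j t
      fits j {t} m c e with σ-injective φ (trans e (sym (σσ⁻¹ φ j)))
      ... | refl = subst (λ e → Matches c e t) (Decidable⇒UIP.≡-irrelevant Finₚ._≟_ (σσ⁻¹ φ j) e) m

      matching : ∀ c {j} (e : σ φ c ≡ j) → Any (Matches c e) (proj₁ (C.contractions-finite j))
      matching c e = proj₂ (C.contractions-finite _) (subst C.ContractionFrom e (transported c))

      to-object : (t : Choice) → (∀ j → Fits j (t j)) → GpdData.Mor (HFib d₁ a) (Y , φ) (object t)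
      to-object t fit = h , ≈ₚ⇒≈ {h = compFH (proj₂ (object t)) (F₁ d₁ h)} {φ} ((λ _ → refl) , λ _ _ → refl)
        where
          β : ∀ c → PosetIso (Q c) (proj₁ (t (σ φ c)))
          β c = proj₁ (fit (σ φ c) c refl)

          square : ∀ c u → fun (β c) (map (f c) u) ≡ map (proj₂ (t (σ φ c))) (fun (α c) u)
          square c u = trans (cong (fun (β c) ∘ map (f c)) (sym (inv-fun (α c) u)))
                             (proj₂ (fit (σ φ c) c refl) (fun (α c) u))

          h : FamHom Y (proj₁ (object t))
          h = record { σ = σ φ ; σ⁻¹ = σ⁻¹ φ ; σ⁻¹σ = σ⁻¹σ φ ; σσ⁻¹ = σσ⁻¹ φ
                     ; comp = λ c → α c , ChainIso₁ (proj₂ (at Y c)) (β c) (square c) }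

      reaches-object : Any (GpdData.Mor (HFib d₁ a) (Y , φ)) objects
      reaches-object = Anyₚ.gmap (λ {t} → to-object t)
        (allΠ⁺ Fits (λ j → Any.map (λ {t} → fits j {t}) (matching (σ⁻¹ φ j) (σσ⁻¹ φ j))))

  classes : FiniteUpTo (GpdData.Mor (HFib d₁ a))
  classes = objects , λ (Y , φ) → reaches-object Y φ

-- Locally finite length

size₁ : ∀ {m} → Elt (suc m) → ℕ
size₁ (P , _∷_ {Q = Q} f c) = size Q

size₁≤size : ∀ {m} (e : Elt (suc m)) → size₁ e ≤ size (proj₁ e)
size₁≤size (P , f ∷ c) = surjective⇒≥ (surjective f)

tail : ∀ {m} → Elt (suc (suc m)) → Elt (suc m)
tail (P , f ∷ c) = _ , c

size-tail : ∀ {m} (e : Elt (suc (suc m))) → size (proj₁ (tail e)) ≡ size₁ e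
size-tail (P , f ∷ c) = refl

-- Pⱼ ↠ Pⱼ₊₁ preserves size, where P₀ ↠ P₁ ↠ ⋯ is the chain of the element
SizePreservingAt : ∀ {m} → Fin (suc m) → Elt (suc m) → Set
SizePreservingAt zero e = size (proj₁ e) ≡ size₁ e
SizePreservingAt {suc m} (suc j) e = SizePreservingAt j (tail e)

preserving-or-shrinking : ∀ {m k} (xs : Fin k → Elt (suc m)) →
                          (∀ c → SizePreservingAt zero (xs c)) ⊎ sum (size₁ ∘ xs) < sum (size ∘ proj₁ ∘ xs)
preserving-or-shrinking {k = k} xs with Finₚ.all? (λ c → size (proj₁ (xs c)) ≟ size₁ (xs c))
... | yes preserving = inj₁ preserving
... | no ¬preserving with Finₚ.¬∀⟶∃¬ k _ (λ c → size (proj₁ (xs c)) ≟ size₁ (xs c)) ¬preserving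
... | c , shrinks = inj₂ (sum-mono-< (size₁≤size ∘ xs) c (≤∧≢⇒< (size₁≤size (xs c)) (shrinks ∘ sym)))

-- Every level that is not size preserving in all components lowers the total size.
common-size-preserving-level : ∀ m {k} (xs : Fin k → Elt (suc m)) → sum (size ∘ proj₁ ∘ xs) ≤ m →
                               ∃ λ j → ∀ c → SizePreservingAt j (xs c)
common-size-preserving-level m xs total≤m with preserving-or-shrinking xs
common-size-preserving-level m xs total≤m | inj₁ preserving = zero , preserving
common-size-preserving-level zero xs total≤0 | inj₂ shrinking = ⊥-elim (n≮0 (<-≤-trans shrinking total≤0))
common-size-preserving-level (suc m) xs total≤m | inj₂ shrinking =
  let j , preserving = common-size-preserving-level m (tail ∘ xs) (≤-pred tails-smaller) in suc j , preserving
  where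
    tails-smaller : sum (size ∘ proj₁ ∘ tail ∘ xs) < suc m
    tails-smaller = begin-strict
      sum (size ∘ proj₁ ∘ tail ∘ xs)  ≡⟨ sum-cong-≗ (size-tail ∘ xs) ⟩
      sum (size₁ ∘ xs)                <⟨ shrinking ⟩
      sum (size ∘ proj₁ ∘ xs)         ≤⟨ total≤m ⟩
      suc m                           ∎
      where open ≤-Reasoning

-- A size-preserving contraction is an isomorphism, so it can be absorbed into the next one.
size-preserving⇒degenerate : ∀ {P m} (j : Fin (suc m)) (c : Chain P (suc m)) → SizePreservingAt j (P , c) →
                             Σ (Chain P m) λ y → ChainIso (degenChain (inject₁ j) y) c (idIso P)
size-preserving⇒degenerate zero (f ∷ []) preserving =
  [] , cons {β = contraction-iso f (≤-reflexive preserving)} nil (λ _ → refl)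
size-preserving⇒degenerate zero (f ∷ (g ∷ c)) preserving =
  (precompose iso g ∷ c) , cons {β = iso} (cons {β = idIso _} (idChainIso c) (λ _ → refl)) (λ _ → refl)
  where
    iso : PosetIso _ _
    iso = contraction-iso f (≤-reflexive preserving)
size-preserving⇒degenerate {m = suc m} (suc zero) (f ∷ c) preserving =
  let y , r = size-preserving⇒degenerate zero c preserving in f ∷ y , cons r (λ _ → refl)
size-preserving⇒degenerate {m = suc m} (suc (suc j)) (f ∷ c) preserving =
  let y , r = size-preserving⇒degenerate (suc j) c preserving in f ∷ y , cons r (λ _ → refl)

size-preserving⇒Degenerate : ∀ {m} (x : Fam (Elt (suc m))) j → (∀ c → SizePreservingAt j (at x c)) →
                             Degenerate (suc m) x
size-preserving⇒Degenerate {m} x j preserving = inject₁ j , y , record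
  { σ = id ; σ⁻¹ = id ; σ⁻¹σ = λ _ → refl ; σσ⁻¹ = λ _ → refl
  ; comp = λ c → idIso _ , proj₂ (degenerate c) }
  where
    degenerate : ∀ c → Σ (Chain (proj₁ (at x c)) m) λ y →
                         ChainIso (degenChain (inject₁ j) y) (proj₂ (at x c)) (idIso _)
    degenerate c = size-preserving⇒degenerate j (proj₂ (at x c)) (preserving c)
    y : Fam (Elt m)
    y = record { card = card x ; at = λ c → proj₁ (at x c) , proj₁ (degenerate c) }

-- Over a, the total size of the posets P₀ is at most card a * M, so a chain of more than that
-- many contractions has a level where no component shrinks.
longEdge-fibre-finiteLength : ∀ a → ∃ λ N → ∀ m → N ≤ m →
                              ¬ (Σ (GpdData.Ob (HFib (longEdge m) a)) λ p → ¬ Degenerate m (proj₁ p))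
longEdge-fibre-finiteLength a = suc (card a * M) , bounded
  where
    M : ℕ
    M = sum (size ∘ proj₁ ∘ at a)

    bounded : ∀ m → suc (card a * M) ≤ m → ¬ (Σ (GpdData.Ob (HFib (longEdge m) a)) λ p → ¬ Degenerate m (proj₁ p))
    bounded (suc m) (s≤s N≤m) ((x , φ) , nondegenerate) =
      let j , preserving = common-size-preserving-level m (at x) total≤m in
      nondegenerate (size-preserving⇒Degenerate x j preserving)
      where
        component≤M : ∀ c → size (proj₁ (at x c)) ≤ M
        component≤M c = ≤-trans (≤-reflexive (PosetIso-size (proj₁ (comp φ c))))
                                (≤-sum (size ∘ proj₁ ∘ at a) (σ φ c))
        total≤m : sum (size ∘ proj₁ ∘ at x) ≤ m
        total≤m = ≤-trans (sum-≤-* component≤M)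
                          (≤-trans (*-monoˡ-≤ M (Finₚ.injective⇒≤ (σ-injective φ))) N≤m)

proposition3p10 : KLocallyFinite × KLocallyDiscrete × KLocallyFiniteLength
proposition3p10 =
  ( K₁-locallyFinite
  , (λ a → s₀-fibre-classes a , s₀-fibre-locallyFinite a)
  , (λ a → d₁-Fibre.classes a , keepFirst-fibre-locallyFinite 1 a) )
  , (s₀-fibre-discrete , keepFirst-fibre-discrete 1)
  , longEdge-fibre-finiteLength
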